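{- For $e\in\{1,2,3,4\}$, the set $U_{e,!}$ is absolute: for every $n\in\mathbb{Z}^+$ there exists an integer $r_n\geq 0$ such that $S_{e,!}^r(n)\in U_{e,!}$ for all integers $r\geq r_n$.
   Context: Every positive integer $n$ has a unique factorial base representation $n=\sum_{i=1}^k a_i\cdot i!$ with $a_k\neq 0$ and $0\leq a_i\leq i$ for $1\leq i\leq k$. For an integer $e\geq 1$, define $S_{e,!}:\mathbb{Z}_{\geq 0}\to\mathbb{Z}_{\geq 0}$ by $S_{e,!}(0)=0$ and $S_{e,!}(n)=\sum_{i=1}^k a_i^e$ for $n\geq 1$; $S_{e,!}^{\ell}$ denotes the $\ell$-th iterate, $S_{e,!}^0(n)=n$. $U_{e,!}$ is the set of all positive integers $n$ for which there exists $\ell\geq 1$ with $S_{e,!}^{\ell}(n)=n$. -}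

module Defs where

open import Data.Nat using (ℕ; zero; suc; _+_; _^_; _<_; _≤_)
open import Data.Nat.DivMod using (_%_; _/_)
open import Data.List using (List; []; _∷_; map)
open import Data.Nat.ListAction using (sum)
open import Relation.Binary.PropositionalEquality using (_≡_; refl)
open import Data.Product using (∃; _×_)
open import Function using (_∘_)

-- The fuel argument bounds the number of digits; fuel ≥ m
-- suffices, since m / (i+1) < m for m ≥ 1 and i ≥ 1.
-- For n = Σ_{i=1}^k a_i i!, with 0 ≤ a_i ≤ i, we have a_1 = n mod 2 and
-- recursively a_{i} = q_{i-1} mod (i+1), q_i = q_{i-1} / (i+1), q_0 = n.
digitsFrom : (fuel i m : ℕ) → List ℕ
digitsFrom zero    i m = []
digitsFrom (suc f) i zero = []
digitsFrom (suc f) i m@(suc _) = (m % suc i) ∷ digitsFrom f (suc i) (m / suc i)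

factDigits : ℕ → List ℕ
factDigits n = digitsFrom n 1 n

S! : ℕ → ℕ → ℕ
S! e n = sum (map (λ a → a ^ e) (factDigits n))

iter : (ℕ → ℕ) → ℕ → ℕ → ℕ
iter f zero    n = n
iter f (suc ℓ) n = f (iter f ℓ n)

U! : ℕ → ℕ → Set
U! e n = 0 < n × ∃ λ ℓ → 1 ≤ ℓ × iter (S! e) ℓ n ≡ n

{-# OPTIONS --safe #-}
-- A digit a at position i ≥ 6 contributes a^e ≤ a · i!/2 to S_{e,!}, because a^e ≤ a · i³ for
-- e ≤ 4 and 2 i³ ≤ i!; at the positions i ≤ 5 it contributes at most i⁴. Summing over the
-- factorial base expansion gives 2 S_{e,!}(m) ≤ m + 1958, so S_{e,!} maps [0, n + 1958] into
-- itself. The orbit of n is therefore finite, hence eventually periodic by pigeonhole, and it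
-- consists of positive integers because a positive number has a nonzero digit.

module Submission where

open import Defs
open import Data.Nat using (ℕ; _<_; _≤_)
open import Data.Product using (∃; _×_)

open import Data.Nat.Base
open import Data.Nat.Properties
open import Data.Nat.DivMod using (_%_; _/_; m≡m%n+[m/n]*n; m%n<n; m/n<m)
open import Data.Nat.ListAction using (sum)
open import Data.Nat.Tactic.RingSolver using (solve-∀)
open import Data.List.Base using (map; drop; upTo)
open import Data.List.Properties using (drop-[])
open import Data.Fin.Base using (toℕ; fromℕ<)
open import Data.Fin.Properties using (pigeonhole; toℕ-fromℕ<)
open import Data.Product using (∃₂; _,_)
open import Relation.Binary.PropositionalEquality
open import Relation.Nullary using (yes; no; contradiction)
open import Relation.Nullary.Decidable using (toWitness)
open import Algebra.Properties.CommutativeSemigroup *-commutativeSemigroup using (x∙yz≈y∙xz)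

module _ (f : ℕ → ℕ) where

  iter-+ : ∀ a b x → iter f (a + b) x ≡ iter f a (iter f b x)
  iter-+ zero    b x = refl
  iter-+ (suc a) b x = cong f (iter-+ a b x)

  iter-preserves : (P : ℕ → Set) → (∀ {m} → P m → P (f m)) → ∀ {x} r → P x → P (iter f r x)
  iter-preserves P f-pres zero    Px = Px
  iter-preserves P f-pres (suc r) Px = f-pres (iter-preserves P f-pres r Px)

  iter-periodic : ∀ p {x} → iter f p x ≡ x → ∀ t → iter f p (iter f t x) ≡ iter f t x
  iter-periodic p {x} px≡x t = begin
    iter f p (iter f t x) ≡⟨ iter-+ p t x ⟨
    iter f (p + t) x      ≡⟨ cong (λ s → iter f s x) (+-comm p t) ⟩
    iter f (t + p) x      ≡⟨ iter-+ t p x ⟩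
    iter f t (iter f p x) ≡⟨ cong (iter f t) px≡x ⟩
    iter f t x            ∎
    where open ≡-Reasoning

  bounded-orbit-repeats : ∀ M x → (∀ r → iter f r x ≤ M) →
                          ∃₂ λ a b → a < b × iter f a x ≡ iter f b x
  bounded-orbit-repeats M x bounded
    with i , j , i<j , hi≡hj ← pigeonhole (n<1+n (suc M)) (λ k → fromℕ< (s≤s (bounded (toℕ k))))
    = toℕ i , toℕ j , i<j , (begin
      iter f (toℕ i) x                     ≡⟨ toℕ-fromℕ< _ ⟨
      toℕ (fromℕ< (s≤s (bounded (toℕ i)))) ≡⟨ cong toℕ hi≡hj ⟩
      toℕ (fromℕ< (s≤s (bounded (toℕ j)))) ≡⟨ toℕ-fromℕ< _ ⟩
      iter f (toℕ j) x                     ∎)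
    where open ≡-Reasoning

  bounded-orbit-eventually-periodic :
    ∀ M → (∀ {m} → m ≤ M → f m ≤ M) → ∀ {x} → x ≤ M →
    ∃₂ λ a p → 1 ≤ p × ∀ r → a ≤ r → iter f p (iter f r x) ≡ iter f r x
  bounded-orbit-eventually-periodic M f-maps {x} x≤M
    with a , b , a<b , xa≡xb ← bounded-orbit-repeats M x (λ r → iter-preserves (_≤ M) f-maps r x≤M)
    = a , b ∸ a , m<n⇒0<n∸m a<b , periodic-from-a
    where
      open ≡-Reasoning
      xa-periodic : iter f (b ∸ a) (iter f a x) ≡ iter f a x
      xa-periodic = begin
        iter f (b ∸ a) (iter f a x) ≡⟨ iter-+ (b ∸ a) a x ⟨
        iter f (b ∸ a + a) x        ≡⟨ cong (λ s → iter f s x) (m∸n+n≡m (<⇒≤ a<b)) ⟩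
        iter f b x                  ≡⟨ xa≡xb ⟨
        iter f a x                  ∎
      periodic-from-a : ∀ r → a ≤ r → iter f (b ∸ a) (iter f r x) ≡ iter f r x
      periodic-from-a r a≤r = begin
        iter f (b ∸ a) (iter f r x)           ≡⟨ cong (λ s → iter f (b ∸ a) (iter f s x)) r≡ ⟩
        iter f (b ∸ a) (iter f (t + a) x)     ≡⟨ cong (iter f (b ∸ a)) (iter-+ t a x) ⟩
        iter f (b ∸ a) (iter f t (iter f a x)) ≡⟨ iter-periodic (b ∸ a) xa-periodic t ⟩
        iter f t (iter f a x)                 ≡⟨ iter-+ t a x ⟨
        iter f (t + a) x                      ≡⟨ cong (λ s → iter f s x) r≡ ⟨
        iter f r x                            ∎
        where
          t = r ∸ a
          r≡ : r ≡ t + a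
          r≡ = sym (m∸n+n≡m a≤r)

[7+j]²≤[6+j]³ : ∀ j → (7 + j) ^ 2 ≤ (6 + j) ^ 3
[7+j]²≤[6+j]³ j = subst ((7 + j) ^ 2 ≤_) (expand j) (m≤m+n _ _)
  where
    expand : ∀ j → (7 + j) * ((7 + j) * 1) + (j * j * j + 17 * j * j + 94 * j + 167)
                 ≡ (6 + j) * ((6 + j) * ((6 + j) * 1))
    expand = solve-∀

2*n³≤n! : ∀ j → 2 * (6 + j) ^ 3 ≤ (6 + j) !
2*n³≤n! zero    = toWitness {a? = 2 * 6 ^ 3 ≤? 6 !} _
2*n³≤n! (suc j) = begin
  2 * (7 + j) ^ 3               ≡⟨ x∙yz≈y∙xz 2 (7 + j) ((7 + j) ^ 2) ⟩
  (7 + j) * (2 * (7 + j) ^ 2)   ≤⟨ *-monoʳ-≤ (7 + j) (*-monoʳ-≤ 2 ([7+j]²≤[6+j]³ j)) ⟩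
  (7 + j) * (2 * (6 + j) ^ 3)   ≤⟨ *-monoʳ-≤ (7 + j) (2*n³≤n! j) ⟩
  (7 + j) * (6 + j) !           ∎
  where open ≤-Reasoning

-- Σ_{j=i}^{5} 2 j⁴, with slack 1 = 1958: below position 6 a digit a ≤ j only satisfies a^e ≤ j⁴.
slack : ℕ → ℕ
slack i = sum (map (λ j → 2 * j ^ 4) (drop i (upTo 6)))

slack-unfold : ∀ {i} → i < 6 → slack i ≡ 2 * i ^ 4 + slack (suc i)
slack-unfold {0} _ = refl
slack-unfold {1} _ = refl
slack-unfold {2} _ = refl
slack-unfold {3} _ = refl
slack-unfold {4} _ = refl
slack-unfold {5} _ = refl
slack-unfold {suc (suc (suc (suc (suc (suc _)))))} (s≤s (s≤s (s≤s (s≤s (s≤s (s≤s ()))))))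

slack-6+ : ∀ j → slack (6 + j) ≡ 0
slack-6+ j = cong (λ xs → sum (map (λ j → 2 * j ^ 4) xs)) (drop-[] j)

^-mono-≤ : ∀ {a i} e {k} → e ≤ k → a ≤ i → a ^ suc e ≤ i ^ suc k
^-mono-≤ {zero}  e e≤k a≤i = z≤n
^-mono-≤ {suc a} e {k} e≤k a≤i = ≤-trans (^-monoʳ-≤ (suc a) (s≤s e≤k)) (^-monoˡ-≤ (suc k) a≤i)

digit-step-≥6 : ∀ {a} j e → e ≤ 3 → a ≤ 6 + j → 2 * a ^ suc e ≤ a * (6 + j) !
digit-step-≥6 {zero}  j e e≤3 a≤i = z≤n
digit-step-≥6 {suc a} j e e≤3 a≤i = begin
  2 * (suc a * suc a ^ e)         ≡⟨ x∙yz≈y∙xz 2 (suc a) (suc a ^ e) ⟩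
  suc a * (2 * suc a ^ e)         ≤⟨ *-monoʳ-≤ (suc a) (*-monoʳ-≤ 2 a^e≤i³) ⟩
  suc a * (2 * (6 + j) ^ 3)       ≤⟨ *-monoʳ-≤ (suc a) (2*n³≤n! j) ⟩
  suc a * (6 + j) !               ∎
  where
    open ≤-Reasoning
    a^e≤i³ = ≤-trans (^-monoʳ-≤ (suc a) e≤3) (^-monoˡ-≤ 3 a≤i)

digit-step : ∀ {e a} i → 1 ≤ e → e ≤ 4 → a ≤ i → 2 * a ^ e + slack (suc i) ≤ a * i ! + slack i
digit-step {suc e} {a} i _ e≤4 a≤i with i <? 6
... | yes i<6 = begin
  2 * a ^ suc e + slack (suc i) ≤⟨ +-monoˡ-≤ _ (*-monoʳ-≤ 2 (^-mono-≤ e (s≤s⁻¹ e≤4) a≤i)) ⟩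
  2 * i ^ 4 + slack (suc i)     ≡⟨ slack-unfold i<6 ⟨
  slack i                       ≤⟨ m≤n+m _ _ ⟩
  a * i ! + slack i             ∎
  where open ≤-Reasoning
... | no i≮6 with j , refl ← m≤n⇒∃[o]m+o≡n (≮⇒≥ i≮6) rewrite slack-6+ (suc j) | slack-6+ j =
  +-monoˡ-≤ 0 (digit-step-≥6 j e (s≤s⁻¹ e≤4) a≤i)

digitPowerSum : (e fuel i m : ℕ) → ℕ
digitPowerSum e fuel i m = sum (map (_^ e) (digitsFrom fuel i m))

-- m · i! is the value Σ_{j ≥ i} a_j j! of the digits from position i on.
digitPowerSum-bound : ∀ {e} → 1 ≤ e → e ≤ 4 → ∀ fuel i m →
                      2 * digitPowerSum e fuel i m ≤ m * i ! + slack i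
digitPowerSum-bound _   _   zero       i m         = z≤n
digitPowerSum-bound _   _   (suc fuel) i zero      = z≤n
digitPowerSum-bound {e} 1≤e e≤4 (suc fuel) i m@(suc _) = begin
  2 * (d ^ e + rest)                          ≡⟨ *-distribˡ-+ 2 (d ^ e) rest ⟩
  2 * d ^ e + 2 * rest                        ≤⟨ +-monoʳ-≤ (2 * d ^ e) (digitPowerSum-bound 1≤e e≤4 fuel (suc i) q) ⟩
  2 * d ^ e + (q * suc i ! + slack (suc i))   ≡⟨ regroup (2 * d ^ e) (q * suc i !) (slack (suc i)) ⟩
  (2 * d ^ e + slack (suc i)) + q * suc i !   ≤⟨ +-monoˡ-≤ (q * suc i !) (digit-step i 1≤e e≤4 d≤i) ⟩
  (d * i ! + slack i) + q * (suc i * i !)     ≡⟨ collect d (i !) (slack i) q (suc i) ⟩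
  (d + q * suc i) * i ! + slack i             ≡⟨ cong (λ x → x * i ! + slack i) (m≡m%n+[m/n]*n m (suc i)) ⟨
  m * i ! + slack i                           ∎
  where
    open ≤-Reasoning
    d = m % suc i
    q = m / suc i
    rest = digitPowerSum e fuel (suc i) q
    d≤i = s≤s⁻¹ (m%n<n m (suc i))
    regroup : ∀ x y z → x + (y + z) ≡ (x + z) + y
    regroup = solve-∀
    collect : ∀ d f s q n → (d * f + s) + q * (n * f) ≡ (d + q * n) * f + s
    collect = solve-∀

quotient-pos : ∀ m n .{{_ : NonZero n}} → m % n ≡ 0 → 0 < m → 0 < m / n
quotient-pos m n m%n≡0 0<m with m / n | m≡m%n+[m/n]*n m n
... | suc _ | _ = z<s
... | zero  | m≡ = contradiction (trans m≡ (cong (_+ 0) m%n≡0)) (≢-nonZero⁻¹ m {{>-nonZero 0<m}})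

digitPowerSum-pos : ∀ e fuel i m → 1 ≤ i → 0 < m → m ≤ fuel → 0 < digitPowerSum e fuel i m
digitPowerSum-pos e (suc fuel) i m@(suc _) 1≤i 0<m m≤fuel with m % suc i in m%≡
... | suc d = ≤-trans (m^n>0 (suc d) e) (m≤m+n _ _)
... | zero  = ≤-trans (digitPowerSum-pos e fuel (suc i) (m / suc i) z<s
                        (quotient-pos m (suc i) m%≡ 0<m) q≤fuel) (m≤n+m _ _)
  where q≤fuel = s≤s⁻¹ (≤-trans (m/n<m m (suc i) (s≤s 1≤i)) m≤fuel)

S!-bound : ∀ {e} → 1 ≤ e → e ≤ 4 → ∀ m → 2 * S! e m ≤ m + 1958
S!-bound {e} 1≤e e≤4 m = subst (λ x → 2 * S! e m ≤ x + 1958) (*-identityʳ m)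
                           (digitPowerSum-bound 1≤e e≤4 m 1 m)

S!-maps-≤ : ∀ {e M} → 1 ≤ e → e ≤ 4 → 1958 ≤ M → ∀ {m} → m ≤ M → S! e m ≤ M
S!-maps-≤ {e} {M} 1≤e e≤4 1958≤M {m} m≤M = *-cancelˡ-≤ 2 (begin
  2 * S! e m ≤⟨ S!-bound 1≤e e≤4 m ⟩
  m + 1958   ≤⟨ +-mono-≤ m≤M 1958≤M ⟩
  M + M      ≡⟨ cong (M +_) (+-identityʳ M) ⟨
  2 * M      ∎)
  where open ≤-Reasoning

S!-pos : ∀ e {m} → 0 < m → 0 < S! e m
S!-pos e {m} 0<m = digitPowerSum-pos e m 1 m ≤-refl 0<m ≤-refl

proposition2p8 : (e : ℕ) → 1 ≤ e → e ≤ 4 → (n : ℕ) → 0 < n →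
    ∃ λ rₙ → (r : ℕ) → rₙ ≤ r → U! e (iter (S! e) r n)
proposition2p8 e 1≤e e≤4 n 0<n =
  let a , p , 1≤p , periodic = bounded-orbit-eventually-periodic (S! e) (n + 1958)
                                 (S!-maps-≤ 1≤e e≤4 (m≤n+m 1958 n)) (m≤m+n n 1958)
  in  a , λ r a≤r → iter-preserves (S! e) (0 <_) (S!-pos e) r 0<n , p , 1≤p , periodic r a≤r
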